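{- Let $U \subset \mathbb{Z}[X]$ be an Ulam sequence starting with $1, X$. Then $U \cap [1, 2X+1] = \{1\} \cup [X, 2X]$.
   Context: $\mathbb{Z}[X]$ is ordered lexicographically: $p(X) > q(X)$ iff the leading coefficient of $p(X) - q(X)$ is positive. For $x \le y$ in $\mathbb{Z}[X]$, $[x,y] = \{z \in \mathbb{Z}[X] : x \le z \le y\}$, and $(-\infty,p)$, $(b,\infty)$ etc. are defined analogously. Let $G_d$ be the additive subgroup of $\mathbb{Z}[X]$ generated by $1, X, \dots, X^d$. Given $0 < a < b$ in $\mathbb{Z}[X]$, an Ulam sequence starting with $a,b$ is a set $U \subset G_{\deg b}$ such that (1) $U \cap (-\infty, b] = \{a,b\}$; (2) for all $p < q$ in $G_{\deg b}$, $U \cap [p,q]$ has both a minimum and a maximum; (3) for every $p \in (b,\infty)$, $p \in U$ iff $p$ is the smallest element of the set of $q \in G_{\deg b}$ with $q$ larger than every element of $U \cap (-\infty,p)$ and such that there is exactly one pair $x \ne y$ in $U$ with $q = x + y$. -}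

module Defs where

open import Data.Nat using (ℕ; suc)
open import Data.Integer using (ℤ; 0ℤ; 1ℤ; _+_; _-_) renaming (_<_ to _<ℤ_)
open import Data.Integer.Properties using () renaming (_≟_ to _≟ℤ_)
open import Data.Vec using (Vec; []; _∷_; zipWith)
open import Data.Product using (Σ; _×_; _,_)
open import Data.Sum using (_⊎_)
open import Relation.Nullary using (¬_; yes; no)
open import Relation.Binary.PropositionalEquality using (_≡_; _≢_)

-- G d : the additive subgroup of ℤ[X] generated by 1, X, …, X^d,
-- i.e. polynomials of degree ≤ d.  An element is its coefficient vector
-- listed from the coefficient of X^d DOWN to the constant coefficient.
G : ℕ → Set
G d = Vec ℤ (suc d)

_⊕_ : ∀ {d} → G d → G d → G d
_⊕_ = zipWith _+_

_⊖_ : ∀ {d} → G d → G d → G d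
_⊖_ = zipWith _-_

lead : ∀ {n} → Vec ℤ n → ℤ
lead [] = 0ℤ
lead (c ∷ cs) with c ≟ℤ 0ℤ
... | yes _ = lead cs
... | no  _ = c

_<ₚ_ : ∀ {d} → G d → G d → Set
p <ₚ q = 0ℤ <ℤ lead (q ⊖ p)

_≤ₚ_ : ∀ {d} → G d → G d → Set
p ≤ₚ q = p <ₚ q ⊎ p ≡ q

Subset : ℕ → Set₁
Subset d = G d → Set

UniqueSumRep : ∀ {d} → Subset d → G d → Set
UniqueSumRep {d} U q =
  Σ (G d) λ x → Σ (G d) λ y →
    U x × U y × x ≢ y × q ≡ x ⊕ y ×
    (∀ x' y' → U x' → U y' → x' ≢ y' → q ≡ x' ⊕ y' →
       (x' ≡ x × y' ≡ y) ⊎ (x' ≡ y × y' ≡ x))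

IsLeast : ∀ {d} → Subset d → G d → Set
IsLeast S p = S p × (∀ q → S q → p ≤ₚ q)

HasMinMaxOnIntervals : ∀ {d} → Subset d → Set
HasMinMaxOnIntervals {d} U =
  ∀ p q → p <ₚ q →
    (Σ (G d) λ z → U z × p ≤ₚ z × z ≤ₚ q) →
    (Σ (G d) λ m → (U m × p ≤ₚ m × m ≤ₚ q) ×
        (∀ z → U z → p ≤ₚ z → z ≤ₚ q → m ≤ₚ z))
    × (Σ (G d) λ M → (U M × p ≤ₚ M × M ≤ₚ q) ×
        (∀ z → U z → p ≤ₚ z → z ≤ₚ q → z ≤ₚ M))

Candidates : ∀ {d} → Subset d → G d → Subset d
Candidates U p q = (∀ u → U u → u <ₚ p → u <ₚ q) × UniqueSumRep U q

-- U ⊆ G d is an Ulam sequence starting with a, b (where d = deg b;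
-- the caller fixes d to be the degree of b)
record IsUlamSequence {d : ℕ} (a b : G d) (U : Subset d) : Set where
  field
    initial : ∀ p → p ≤ₚ b → (U p → p ≡ a ⊎ p ≡ b) × (p ≡ a ⊎ p ≡ b → U p)
    minmax  : HasMinMaxOnIntervals U
    rule    : ∀ p → b <ₚ p → (U p → IsLeast (Candidates U p) p)
                            × (IsLeast (Candidates U p) p → U p)

one₁ X₁ twoX₁ twoX+1₁ : G 1
one₁    = 0ℤ ∷ 1ℤ ∷ []
X₁      = 1ℤ ∷ 0ℤ ∷ []
twoX₁   = Data.Integer.+ 2 ∷ 0ℤ ∷ []
twoX+1₁ = Data.Integer.+ 2 ∷ 1ℤ ∷ []

{-# OPTIONS --safe #-}
-- Every member of U other than 1 is at least X, and two distinct members that are at least X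
-- sum to more than 2X.  So on (X, 2X] the only representations as a sum of two distinct members
-- are 1 + c with c ∈ U, c ≠ 1, and the successor rule makes a point of (X, 2X] a member exactly
-- when its predecessor is.  Going up from X gives X + n ∈ U for all n ≥ 0; these are unbounded
-- below 2X, so the maximum of U ∩ [X, 2X] has the form 2X − k, and going up and down from it
-- gives 2X − m ∈ U for all m.  Finally 2X + 1 = 1 + 2X = X + (X + 1) has two representations.
module Submission where

open import Defs
open import Data.Empty using (⊥-elim)
open import Data.Integer using (ℤ; +_; 0ℤ; 1ℤ; _+_; _-_; -_; _<_; _≤_; +<+; +≤+; -<+; -≤+)
open import Data.Integer.Properties
  using (_≟_; <-cmp; <-irrefl; <⇒≤; <⇒≱; ≰⇒>; ≮⇒≥; ≤-refl; ≤-reflexive; ≤-antisym; +-comm; +-identityˡ;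
         +-mono-<-≤; +-mono-≤-<; i≡j⇒i-j≡0; i-j≡0⇒i≡j; i≤j⇒i-j≤0; i-j≤0⇒i≤j; i<j⇒suc[i]≤j;
         suc[i]≤j⇒i<j; <-strictTotalOrder; +-0-abelianGroup)
open import Algebra.Properties.AbelianGroup +-0-abelianGroup using () renaming (∙-cancelˡ to +-cancelˡ)
open import Data.Nat using (ℕ; zero; suc; s≤s; z≤n)
open import Data.Product using (∃; _×_; _,_; proj₁; proj₂; uncurry)
import Data.Product as Product
open import Data.Product.Relation.Binary.Lex.Strict using (×-Lex; ×-strictTotalOrder)
open import Data.Sum using (_⊎_; inj₁; inj₂; [_,_])
import Data.Sum as Sum
open import Data.Vec using (Vec; []; _∷_; zipWith)
open import Data.Vec.Properties using (zipWith-comm; ∷-injective)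
open import Function using (_∘_)
open import Relation.Binary using (StrictTotalOrder; tri<; tri≈; tri>)
open import Relation.Binary.PropositionalEquality using (_≡_; _≢_; refl; sym; trans; cong; cong₂; subst)
open import Relation.Nullary using (¬_; yes; no)

infix 5 _X+_
pattern _X+_ a b = a ∷ b ∷ []

coeffs : G 1 → ℤ × ℤ
coeffs (a X+ b) = a , b

+-tight : ∀ {i j k l} → i ≤ j → k ≤ l → j + l ≤ i + k → i ≡ j × k ≡ l
+-tight i≤j k≤l j+l≤i+k =
  ≤-antisym i≤j (≮⇒≥ (λ i<j → <⇒≱ (+-mono-<-≤ i<j k≤l) j+l≤i+k)) ,
  ≤-antisym k≤l (≮⇒≥ (λ k<l → <⇒≱ (+-mono-≤-< i≤j k<l) j+l≤i+k))

i<j⇒0<j-i : ∀ {i j} → i < j → 0ℤ < j - i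
i<j⇒0<j-i i<j = ≰⇒> (λ j-i≤0 → <⇒≱ i<j (i-j≤0⇒i≤j j-i≤0))

0<j-i⇒i<j : ∀ {i j} → 0ℤ < j - i → i < j
0<j-i⇒i<j 0<j-i = ≰⇒> (λ j≤i → <⇒≱ 0<j-i (i≤j⇒i-j≤0 j≤i))

ℤ²-lex : StrictTotalOrder _ _ _
ℤ²-lex = ×-strictTotalOrder <-strictTotalOrder <-strictTotalOrder

open StrictTotalOrder ℤ²-lex using ()
  renaming (_<_ to _<ₗₑₓ_; compare to compareₗₑₓ; asym to <ₗₑₓ-asym; irrefl to <ₗₑₓ-irrefl)

_≤ₗₑₓ_ : ℤ × ℤ → ℤ × ℤ → Set
_≤ₗₑₓ_ = ×-Lex _≡_ _<_ _≤_

≤ₗₑₓ⇒≤₁ : ∀ {a b c d} → (a , b) ≤ₗₑₓ (c , d) → a ≤ c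
≤ₗₑₓ⇒≤₁ = [ <⇒≤ , ≤-reflexive ∘ proj₁ ]

≤ₗₑₓ⇒≤₂ : ∀ {a b d} → (a , b) ≤ₗₑₓ (a , d) → b ≤ d
≤ₗₑₓ⇒≤₂ = [ ⊥-elim ∘ <-irrefl refl , proj₂ ]

0<lead⇒0<ₗₑₓ : ∀ u v → 0ℤ < lead (u X+ v) → (0ℤ , 0ℤ) <ₗₑₓ (u , v)
0<lead⇒0<ₗₑₓ u v 0<lead with u ≟ 0ℤ
... | no _ = inj₁ 0<lead
... | yes refl with v ≟ 0ℤ
...   | yes refl = ⊥-elim (<-irrefl refl 0<lead)
...   | no _ = inj₂ (refl , 0<lead)

0<ₗₑₓ⇒0<lead : ∀ u v → (0ℤ , 0ℤ) <ₗₑₓ (u , v) → 0ℤ < lead (u X+ v)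
0<ₗₑₓ⇒0<lead u v 0<uv with u ≟ 0ℤ | 0<uv
... | no _ | inj₁ 0<u = 0<u
... | no u≢0 | inj₂ (0≡u , _) = ⊥-elim (u≢0 (sym 0≡u))
... | yes refl | inj₁ 0<0 = ⊥-elim (<-irrefl refl 0<0)
... | yes refl | inj₂ (_ , 0<v) with v ≟ 0ℤ
...   | yes refl = ⊥-elim (<-irrefl refl 0<v)
...   | no _ = 0<v

<ₗₑₓ⇒<ₚ : ∀ p q → coeffs p <ₗₑₓ coeffs q → p <ₚ q
<ₗₑₓ⇒<ₚ (a X+ b) (c X+ d) (inj₁ a<c) = 0<ₗₑₓ⇒0<lead (c - a) (d - b) (inj₁ (i<j⇒0<j-i a<c))
<ₗₑₓ⇒<ₚ (a X+ b) (c X+ d) (inj₂ (refl , b<d)) =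
  0<ₗₑₓ⇒0<lead (c - a) (d - b) (inj₂ (sym (i≡j⇒i-j≡0 {a} refl) , i<j⇒0<j-i b<d))

<ₚ⇒<ₗₑₓ : ∀ p q → p <ₚ q → coeffs p <ₗₑₓ coeffs q
<ₚ⇒<ₗₑₓ (a X+ b) (c X+ d) p<q with 0<lead⇒0<ₗₑₓ (c - a) (d - b) p<q
... | inj₁ 0<c-a = inj₁ (0<j-i⇒i<j 0<c-a)
... | inj₂ (0≡c-a , 0<d-b) = inj₂ (sym (i-j≡0⇒i≡j c a (sym 0≡c-a)) , 0<j-i⇒i<j 0<d-b)

≤ₚ⇒≤ₗₑₓ : ∀ p q → p ≤ₚ q → coeffs p ≤ₗₑₓ coeffs q
≤ₚ⇒≤ₗₑₓ p q (inj₁ p<q) = Sum.map₂ (Product.map₂ <⇒≤) (<ₚ⇒<ₗₑₓ p q p<q)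
≤ₚ⇒≤ₗₑₓ p q (inj₂ refl) = inj₂ (refl , ≤-refl)

≤ₚ⊎>ₚ : (p q : G 1) → p ≤ₚ q ⊎ q <ₚ p
≤ₚ⊎>ₚ p@(a X+ b) q@(c X+ d) with compareₗₑₓ (a , b) (c , d)
... | tri< p<q _ _ = inj₁ (inj₁ (<ₗₑₓ⇒<ₚ p q p<q))
... | tri≈ _ (refl , refl) _ = inj₁ (inj₂ refl)
... | tri> _ _ q<p = inj₂ (<ₗₑₓ⇒<ₚ q p q<p)

<ₚ⇒≱ₚ : ∀ {p q : G 1} → p <ₚ q → ¬ q ≤ₚ p
<ₚ⇒≱ₚ {p} {q} p<q (inj₁ q<p) = <ₗₑₓ-asym (<ₚ⇒<ₗₑₓ p q p<q) (<ₚ⇒<ₗₑₓ q p q<p)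
<ₚ⇒≱ₚ {p@(_ X+ _)} p<q (inj₂ refl) = <ₗₑₓ-irrefl (refl , refl) (<ₚ⇒<ₗₑₓ p p p<q)

≤ₚ-antisym : ∀ {p q : G 1} → p ≤ₚ q → q ≤ₚ p → p ≡ q
≤ₚ-antisym (inj₁ p<q) q≤p = ⊥-elim (<ₚ⇒≱ₚ p<q q≤p)
≤ₚ-antisym (inj₂ p≡q) _ = p≡q

one⊕X+ : ∀ a b → one₁ ⊕ (a X+ b) ≡ a X+ (1ℤ + b)
one⊕X+ a b = cong (_X+ (1ℤ + b)) (+-identityˡ a)

<ₚ-one⊕ : (p : G 1) → p <ₚ (one₁ ⊕ p)
<ₚ-one⊕ p@(a X+ b) =
  subst (p <ₚ_) (sym (one⊕X+ a b)) (<ₗₑₓ⇒<ₚ p (a X+ (1ℤ + b)) (inj₂ (refl , suc[i]≤j⇒i<j ≤-refl)))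

<ₚ⇒one⊕≤ₚ : ∀ {p q : G 1} → p <ₚ q → (one₁ ⊕ p) ≤ₚ q
<ₚ⇒one⊕≤ₚ {p@(a X+ b)} {q@(c X+ d)} p<q = subst (_≤ₚ q) (sym (one⊕X+ a b)) (next≤ (<ₚ⇒<ₗₑₓ p q p<q))
  where
  next≤ : (a , b) <ₗₑₓ (c , d) → (a X+ (1ℤ + b)) ≤ₚ q
  next≤ (inj₁ a<c) = inj₁ (<ₗₑₓ⇒<ₚ (a X+ (1ℤ + b)) q (inj₁ a<c))
  next≤ (inj₂ (refl , b<d)) with <-cmp (1ℤ + b) d
  ... | tri< 1+b<d _ _ = inj₁ (<ₗₑₓ⇒<ₚ (a X+ (1ℤ + b)) q (inj₂ (refl , 1+b<d)))
  ... | tri≈ _ refl _ = inj₂ refl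
  ... | tri> _ _ d<1+b = ⊥-elim (<⇒≱ d<1+b (i<j⇒suc[i]≤j b<d))

⊕-comm : ∀ {d} (x y : G d) → x ⊕ y ≡ y ⊕ x
⊕-comm = zipWith-comm +-comm

zipWith-+-cancelˡ : ∀ {n} (x : Vec ℤ n) {y z} → zipWith _+_ x y ≡ zipWith _+_ x z → y ≡ z
zipWith-+-cancelˡ [] {[]} {[]} _ = refl
zipWith-+-cancelˡ (a ∷ x) {b ∷ y} {c ∷ z} eq =
  cong₂ _∷_ (+-cancelˡ a b c (proj₁ (∷-injective eq))) (zipWith-+-cancelˡ x (proj₂ (∷-injective eq)))

⊕-cancelˡ : ∀ {d} (x : G d) {y z} → x ⊕ y ≡ x ⊕ z → y ≡ z
⊕-cancelˡ = zipWith-+-cancelˡ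

1<2 : 1ℤ < + 2
1<2 = +<+ (s≤s (s≤s z≤n))

twoX-_ : ℕ → G 1
twoX- k = + 2 X+ - (+ k)

one⊕twoX-suc : ∀ m → one₁ ⊕ (twoX- suc m) ≡ twoX- m
one⊕twoX-suc zero = refl
one⊕twoX-suc (suc m) = refl

X<X+suc : ∀ n → X₁ <ₚ (1ℤ X+ + suc n)
X<X+suc n = <ₗₑₓ⇒<ₚ X₁ (1ℤ X+ + suc n) (inj₂ (refl , +<+ (s≤s z≤n)))

X+n<2X : ∀ n → (1ℤ X+ + n) <ₚ twoX₁
X+n<2X n = <ₗₑₓ⇒<ₚ (1ℤ X+ + n) twoX₁ (inj₁ 1<2)

X<2X : X₁ <ₚ twoX₁
X<2X = X+n<2X 0

X<twoX- : ∀ m → X₁ <ₚ (twoX- m)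
X<twoX- m = <ₗₑₓ⇒<ₚ X₁ (twoX- m) (inj₁ 1<2)

twoX-≤2X : ∀ m → (twoX- m) ≤ₚ twoX₁
twoX-≤2X zero = inj₂ refl
twoX-≤2X (suc m) = inj₁ (<ₗₑₓ⇒<ₚ (twoX- suc m) twoX₁ (inj₂ (refl , -<+)))

both≥X∧sum≤2X⇒both≡X : ∀ x y → X₁ ≤ₚ x → X₁ ≤ₚ y → (x ⊕ y) ≤ₚ twoX₁ → x ≡ X₁ × y ≡ X₁
both≥X∧sum≤2X⇒both≡X x@(a X+ b) y@(c X+ d) X≤x X≤y x⊕y≤2X =
  tight (≤ₚ⇒≤ₗₑₓ X₁ x X≤x) (≤ₚ⇒≤ₗₑₓ X₁ y X≤y) (≤ₚ⇒≤ₗₑₓ (x ⊕ y) twoX₁ x⊕y≤2X)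
  where
  tight : (1ℤ , 0ℤ) ≤ₗₑₓ (a , b) → (1ℤ , 0ℤ) ≤ₗₑₓ (c , d) → (a + c , b + d) ≤ₗₑₓ (+ 2 , 0ℤ) →
          x ≡ X₁ × y ≡ X₁
  tight X≤x X≤y x⊕y≤2X with +-tight (≤ₗₑₓ⇒≤₁ X≤x) (≤ₗₑₓ⇒≤₁ X≤y) (≤ₗₑₓ⇒≤₁ x⊕y≤2X)
  ... | refl , refl with +-tight (≤ₗₑₓ⇒≤₂ X≤x) (≤ₗₑₓ⇒≤₂ X≤y) (≤ₗₑₓ⇒≤₂ x⊕y≤2X)
  ...   | refl , refl = refl , refl

[X,2X]-shape : ∀ p → X₁ ≤ₚ p → p ≤ₚ twoX₁ → (∃ λ n → p ≡ 1ℤ X+ + n) ⊎ (∃ λ k → p ≡ twoX- k)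
[X,2X]-shape p@(a X+ b) X≤p p≤2X with ≤ₚ⇒≤ₗₑₓ X₁ p X≤p | ≤ₚ⇒≤ₗₑₓ p twoX₁ p≤2X
... | inj₂ (refl , +≤+ {n = n} _) | _ = inj₁ (n , refl)
... | inj₁ 1<a | inj₁ a<2 = ⊥-elim (<⇒≱ a<2 (i<j⇒suc[i]≤j 1<a))
... | inj₁ _ | inj₂ (refl , +≤+ z≤n) = inj₂ (0 , refl)
... | inj₁ _ | inj₂ (refl , -≤+ {m = k}) = inj₂ (suc k , refl)

uniqueSumRep⇒summand∈pair : ∀ {d} {U : Subset d} {q x y x' y'} → UniqueSumRep U q →
  U x → U y → x ≢ y → q ≡ x ⊕ y → U x' → U y' → x' ≢ y' → q ≡ x' ⊕ y' → x' ≡ x ⊎ x' ≡ y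
uniqueSumRep⇒summand∈pair {x = x} {y} {x'} {y'} (_ , _ , _ , _ , _ , _ , unique)
  x∈U y∈U x≢y q≡x⊕y x'∈U y'∈U x'≢y' q≡x'⊕y'
  with unique x y x∈U y∈U x≢y q≡x⊕y | unique x' y' x'∈U y'∈U x'≢y' q≡x'⊕y'
... | inj₁ (refl , _) | inj₁ (refl , _) = inj₁ refl
... | inj₁ (_ , refl) | inj₂ (refl , _) = inj₂ refl
... | inj₂ (_ , refl) | inj₁ (refl , _) = inj₂ refl
... | inj₂ (refl , _) | inj₂ (refl , _) = inj₁ refl

module UlamSequence {d} {a b : G d} {U : Subset d} (isU : IsUlamSequence a b U) where
  open IsUlamSequence isU

  member⇒uniqueSumRep : ∀ {p} → b <ₚ p → U p → UniqueSumRep U p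
  member⇒uniqueSumRep {p} b<p p∈U = proj₂ (proj₁ (proj₁ (rule p b<p) p∈U))

  successor∈U : ∀ {u p} → U u → u <ₚ p → b <ₚ p → UniqueSumRep U p → (∀ q → u <ₚ q → p ≤ₚ q) → U p
  successor∈U {u} {p} u∈U u<p b<p p-unique p-covers-u =
    proj₂ (rule p b<p) (((λ _ _ w<p → w<p) , p-unique) , least)
    where
    least : ∀ q → Candidates U p q → p ≤ₚ q
    least q (above , _) = p-covers-u q (above u u∈U u<p)

module UlamOneX {U : Subset 1} (isU : IsUlamSequence one₁ X₁ U) where
  open IsUlamSequence isU
  open UlamSequence isU

  one∈U : U one₁
  one∈U = proj₂ (initial one₁ (inj₁ (<ₗₑₓ⇒<ₚ one₁ X₁ (inj₁ (+<+ (s≤s z≤n)))))) (inj₁ refl)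

  X∈U : U X₁
  X∈U = proj₂ (initial X₁ (inj₂ refl)) (inj₂ refl)

  member⇒one⊎≥X : ∀ {p} → U p → p ≡ one₁ ⊎ X₁ ≤ₚ p
  member⇒one⊎≥X {p} p∈U with ≤ₚ⊎>ₚ p X₁
  ... | inj₁ p≤X = Sum.map₂ (λ { refl → inj₂ refl }) (proj₁ (initial p p≤X) p∈U)
  ... | inj₂ X<p = inj₂ (inj₁ X<p)

  sum≤2X⇒summand≡one : ∀ {p x y} → U x → U y → x ≢ y → p ≡ x ⊕ y → p ≤ₚ twoX₁ → x ≡ one₁ ⊎ y ≡ one₁
  sum≤2X⇒summand≡one {x = x} {y} x∈U y∈U x≢y refl x⊕y≤2X with member⇒one⊎≥X x∈U | member⇒one⊎≥X y∈U
  ... | inj₁ x≡1 | _ = inj₁ x≡1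
  ... | inj₂ _ | inj₁ y≡1 = inj₂ y≡1
  ... | inj₂ X≤x | inj₂ X≤y with both≥X∧sum≤2X⇒both≡X x y X≤x X≤y x⊕y≤2X
  ...   | refl , refl = ⊥-elim (x≢y refl)

  uniqueSumRep-one⊕ : ∀ {c} → U c → c ≢ one₁ → (one₁ ⊕ c) ≤ₚ twoX₁ → UniqueSumRep U (one₁ ⊕ c)
  uniqueSumRep-one⊕ {c} c∈U c≢1 1+c≤2X = one₁ , c , one∈U , c∈U , c≢1 ∘ sym , refl , unique
    where
    unique : ∀ x y → U x → U y → x ≢ y → one₁ ⊕ c ≡ x ⊕ y → (x ≡ one₁ × y ≡ c) ⊎ (x ≡ c × y ≡ one₁)
    unique x y x∈U y∈U x≢y 1+c≡x+y with sum≤2X⇒summand≡one x∈U y∈U x≢y 1+c≡x+y 1+c≤2X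
    ... | inj₁ refl = inj₁ (refl , sym (⊕-cancelˡ one₁ 1+c≡x+y))
    ... | inj₂ refl = inj₂ (sym (⊕-cancelˡ one₁ (trans 1+c≡x+y (⊕-comm x one₁))) , refl)

  one⊕-member∈U : ∀ {c p} → U c → c ≢ one₁ → p ≡ one₁ ⊕ c → X₁ <ₚ p → p ≤ₚ twoX₁ → U p
  one⊕-member∈U {c} c∈U c≢1 refl X<p p≤2X =
    successor∈U c∈U (<ₚ-one⊕ c) X<p (uniqueSumRep-one⊕ c∈U c≢1 p≤2X) (λ _ → <ₚ⇒one⊕≤ₚ)

  member⇒one⊕-member : ∀ {p} → U p → X₁ <ₚ p → p ≤ₚ twoX₁ → ∃ λ c → U c × p ≡ one₁ ⊕ c
  member⇒one⊕-member p∈U X<p p≤2X with member⇒uniqueSumRep X<p p∈U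
  ... | x , y , x∈U , y∈U , x≢y , p≡x+y , _ with sum≤2X⇒summand≡one x∈U y∈U x≢y p≡x+y p≤2X
  ...   | inj₁ refl = y , y∈U , p≡x+y
  ...   | inj₂ refl = x , x∈U , trans p≡x+y (⊕-comm x one₁)

  X+n∈U : ∀ n → U (1ℤ X+ + n)
  X+n∈U zero = X∈U
  X+n∈U (suc n) = one⊕-member∈U (X+n∈U n) (λ ()) refl (X<X+suc n) (inj₁ (X+n<2X (suc n)))

  twoX-suc∈U⇒twoX-∈U : ∀ m → U (twoX- suc m) → U (twoX- m)
  twoX-suc∈U⇒twoX-∈U m u = one⊕-member∈U u (λ ()) (sym (one⊕twoX-suc m)) (X<twoX- m) (twoX-≤2X m)

  twoX-∈U⇒twoX-suc∈U : ∀ m → U (twoX- m) → U (twoX- suc m)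
  twoX-∈U⇒twoX-suc∈U m u with member⇒one⊕-member u (X<twoX- m) (twoX-≤2X m)
  ... | c , c∈U , eq = subst U (⊕-cancelˡ one₁ (trans (sym eq) (sym (one⊕twoX-suc m)))) c∈U

  twoX-∈U-for-some : ∃ λ k → U (twoX- k)
  twoX-∈U-for-some with proj₂ (minmax X₁ twoX₁ X<2X (X₁ , X∈U , inj₂ refl , inj₁ X<2X))
  ... | M , (M∈U , X≤M , M≤2X) , maximal with [X,2X]-shape M X≤M M≤2X
  ...   | inj₂ (k , refl) = k , M∈U
  ...   | inj₁ (n , refl) =
    ⊥-elim (<ₚ⇒≱ₚ (<ₚ-one⊕ M) (maximal _ (X+n∈U (suc n)) (inj₁ (X<X+suc n)) (inj₁ (X+n<2X (suc n)))))

  twoX-∈U : ∀ m → U (twoX- m)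
  twoX-∈U m = down m (up (proj₁ twoX-∈U-for-some) (proj₂ twoX-∈U-for-some))
    where
    up : ∀ k → U (twoX- k) → U twoX₁
    up zero u = u
    up (suc k) u = up k (twoX-suc∈U⇒twoX-∈U k u)
    down : ∀ m → U twoX₁ → U (twoX- m)
    down zero u = u
    down (suc m) u = twoX-∈U⇒twoX-suc∈U m (down m u)

  [X,2X]⊆U : ∀ {p} → X₁ ≤ₚ p → p ≤ₚ twoX₁ → U p
  [X,2X]⊆U {p} X≤p p≤2X with [X,2X]-shape p X≤p p≤2X
  ... | inj₁ (n , refl) = X+n∈U n
  ... | inj₂ (k , refl) = twoX-∈U k

  2X+1∉U : ¬ U twoX+1₁
  2X+1∉U 2X+1∈U =
    [ (λ ()) , (λ ()) ] (uniqueSumRep⇒summand∈pair (member⇒uniqueSumRep X<2X+1 2X+1∈U)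
                           one∈U (twoX-∈U 0) (λ ()) refl X∈U (X+n∈U 1) (λ ()) refl)
    where
    X<2X+1 : X₁ <ₚ twoX+1₁
    X<2X+1 = <ₗₑₓ⇒<ₚ X₁ twoX+1₁ (inj₁ 1<2)

  member≤2X+1⇒ : ∀ {p} → U p → p ≤ₚ twoX+1₁ → p ≡ one₁ ⊎ (X₁ ≤ₚ p × p ≤ₚ twoX₁)
  member≤2X+1⇒ {p} p∈U p≤2X+1 with member⇒one⊎≥X p∈U | ≤ₚ⊎>ₚ p twoX₁
  ... | inj₁ p≡1 | _ = inj₁ p≡1
  ... | inj₂ X≤p | inj₁ p≤2X = inj₂ (X≤p , p≤2X)
  ... | inj₂ _ | inj₂ 2X<p = ⊥-elim (2X+1∉U (subst U (≤ₚ-antisym p≤2X+1 (<ₚ⇒one⊕≤ₚ 2X<p)) p∈U))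

lemma2p5 : (U : Subset 1) → IsUlamSequence one₁ X₁ U →
    ∀ p → one₁ ≤ₚ p → p ≤ₚ twoX+1₁ →
      (U p → p ≡ one₁ ⊎ (X₁ ≤ₚ p × p ≤ₚ twoX₁))
      × (p ≡ one₁ ⊎ (X₁ ≤ₚ p × p ≤ₚ twoX₁) → U p)
lemma2p5 U isU p _ p≤2X+1 =
  (λ p∈U → member≤2X+1⇒ p∈U p≤2X+1) , [ (λ { refl → one∈U }) , uncurry [X,2X]⊆U ]
  where open UlamOneX isU
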